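{- Let $p=(12,\{(0,1),(0,2),(1,1),(1,2),(2,0),(2,2)\})$ and $n\ge2$. For each $0\le i\le n-2$, the number of permutations $\pi\in S_n$ in which $n$ has exactly $i$ letters to its right (i.e. $\pi_{n-i}=n$) and which contain $p$ is $i!\,(n-1-i)!$. Consequently \[|S_n(p)| = n!-\sum_{i=0}^{n-2} i!\,(n-i-1)!.\]
   Context: $S_n$ is the set of permutations of $\{1,\dots,n\}$, written $\pi=\pi_1\cdots\pi_n$. A mesh pattern $(12,R)$ of length 2 has $R\subseteq\{0,1,2\}^2$ (shaded boxes). A permutation $\pi\in S_n$ contains $(12,R)$ if there exist indices $i<j$ with $\pi_i<\pi_j$ such that, with $p_0=0,p_1=i,p_2=j,p_3=n+1$ and $v_0=0,v_1=\pi_i,v_2=\pi_j,v_3=n+1$, for every $(a,b)\in R$ there is no index $x$ with $p_a<x<p_{a+1}$ and $v_b<\pi_x<v_{b+1}$. Otherwise $\pi$ avoids it; $S_n(p)$ is the set of avoiders in $S_n$. -}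

module Defs where

open import Data.Bool using (Bool; true; false; _∧_; _∨_; not)
open import Data.Nat using (ℕ; zero; suc; _+_; _*_; _∸_; _<ᵇ_; _≡ᵇ_)
open import Data.Fin using (Fin; toℕ)
open import Data.List using (List; []; _∷_; map; concatMap; allFin; length; filterᵇ)
open import Data.Bool.ListAction using (any; all)
open import Data.Vec using (Vec; lookup) renaming ([] to []ᵥ; _∷_ to _∷ᵥ_)
open import Data.Product using (_×_; _,_)

-- A word of length n over {1,…,n} is encoded as a vector w : Vec (Fin n) n;
-- the letter at (1-based) position x+1 is  toℕ (lookup w x) + 1.

allWords : (n m : ℕ) → List (Vec (Fin n) m)
allWords n zero    = []ᵥ ∷ []
allWords n (suc m) = concatMap (λ a → map (a ∷ᵥ_) (allWords n m)) (allFin n)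

pos : {n : ℕ} → Fin n → ℕ
pos x = suc (toℕ x)

val : {n : ℕ} → Vec (Fin n) n → Fin n → ℕ
val π x = suc (toℕ (lookup π x))

isPerm : {n : ℕ} → Vec (Fin n) n → Bool
isPerm {n} π = all (λ x → all (λ y → not (val π x ≡ᵇ val π y) ∨ (pos x ≡ᵇ pos y)) (allFin n)) (allFin n)

-- the boundaries p_0..p_3 (resp. v_0..v_3): 0, lo, hi, n+1
bound : ℕ → ℕ → ℕ → ℕ → ℕ
bound n lo hi zero                = 0
bound n lo hi (suc zero)          = lo
bound n lo hi (suc (suc zero))    = hi
bound n lo hi (suc (suc (suc _))) = suc n

between : ℕ → ℕ → ℕ → Bool
between a m b = (a <ᵇ m) ∧ (m <ᵇ b)

-- Mesh pattern (12, R), R a list of shaded boxes (a , b) with a , b ∈ {0,1,2}.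
-- π contains (12,R) iff there are indices i < j with π_i < π_j such that for every
-- (a , b) ∈ R no index x has p_a < x < p_{a+1} and v_b < π_x < v_{b+1}.
contains12 : {n : ℕ} → List (ℕ × ℕ) → Vec (Fin n) n → Bool
contains12 {n} R π =
  any (λ i → any (λ j →
    (pos i <ᵇ pos j) ∧ (val π i <ᵇ val π j) ∧
    all (λ { (a , b) →
      not (any (λ x →
        between (bound n (pos i) (pos j) a) (pos x) (bound n (pos i) (pos j) (suc a)) ∧
        between (bound n (val π i) (val π j) b) (val π x) (bound n (val π i) (val π j) (suc b)))
        (allFin n)) }) R)
    (allFin n)) (allFin n)

countPerms : (n : ℕ) → (Vec (Fin n) n → Bool) → ℕ
countPerms n P = length (filterᵇ (λ π → isPerm π ∧ P π) (allWords n n))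

shadingP : List (ℕ × ℕ)
shadingP = (0 , 1) ∷ (0 , 2) ∷ (1 , 1) ∷ (1 , 2) ∷ (2 , 0) ∷ (2 , 2) ∷ []

nHasRight : {n : ℕ} → ℕ → Vec (Fin n) n → Bool
nHasRight {n} i π = any (λ x → (pos x ≡ᵇ n ∸ i) ∧ (val π x ≡ᵇ n)) (allFin n)

-- In an occurrence (i , j) of p the shaded boxes leave no letter above π_j, no letter
-- left of j (other than π_i) above π_i, and no letter right of j outside (π_i , π_j). Hence π_j = n,
-- and if n stands at position J + 1 then pigeonhole gives π_i = J: π = σ n τ with σ a permutation
-- of {1, …, J} and τ one of {J + 1, …, n − 1}. Conversely every such π with J ≥ 1 contains p
-- (take π_i = max σ). Such permutations are the injective words whose letters lie in prescribed
-- disjoint blocks of positions and values, and there are J! (n − 1 − J)! of them. Sorting S_n by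
-- the position of n then counts the avoiders.
module Submission where

open import Defs
open import Data.Bool using (Bool; true; false; _∧_; _∨_; not; T; if_then_else_)
open import Data.Bool.ListAction using (any; all)
open import Data.Bool.Properties using (T-∧; T-∨; T-≡; ∧-comm; ∧-assoc; ∧-zeroʳ; ∧-identityʳ)
open import Data.Empty using (⊥-elim)
open import Data.Fin using (Fin; zero; suc; toℕ; fromℕ; fromℕ<) renaming (_≟_ to _≟ᶠ_)
open import Data.Fin.Properties using (toℕ-injective; toℕ<n; toℕ-fromℕ<; toℕ-fromℕ; injective⇒≤; injective⇒existsPivot)
  renaming (suc-injective to Fin-suc-injective)
open import Data.List using (List; []; _∷_; _++_; _∷ʳ_; map; concatMap; filter; filterᵇ; length; allFin; upTo; applyUpTo; tabulate)
open import Data.List.Membership.Propositional.Properties using (∈-allFin; ∈-filter⁺)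
open import Data.List.Properties using (map-++; map-∘; map-cong; map-cong-local; upTo-∷ʳ; map-tabulate)
open import Data.List.Relation.Unary.All using (All; []; _∷_)
import Data.List.Relation.Unary.All as All
import Data.List.Relation.Unary.All.Properties as All
open import Data.List.Relation.Unary.All.Properties using (all⁺; all⁻; all-filter; all-upTo)
open import Data.List.Relation.Unary.AllPairs using (AllPairs; []; _∷_)
import Data.List.Relation.Unary.AllPairs as AllPairs
import Data.List.Relation.Unary.AllPairs.Properties as AllPairs
import Data.List.Relation.Unary.Any.Properties as Any
open import Data.List.Relation.Unary.Any.Properties using (any⁺; any⁻)
open import Data.Nat using (ℕ; zero; suc; _+_; _*_; _∸_; _≤_; _<_; _⊓_; _!; z≤n; s≤s; s≤s⁻¹; z<s; s<s; s<s⁻¹; _<ᵇ_; _≡ᵇ_)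
open import Data.Nat.ListAction using (sum; product)
open import Data.Nat.ListAction.Properties using (sum-++)
open import Data.Nat.Properties
open import Algebra.Properties.CommutativeSemigroup +-commutativeSemigroup using () renaming (interchange to +-interchange)
open import Data.List.Extrema ≤-totalOrder using (argmax; argmax-all; f[xs]≤f[argmax])
open import Data.Product using (_×_; _,_; proj₁; proj₂; ∃; ∃₂; map₁)
import Data.Product as Product
open import Data.Sum using (_⊎_; inj₁; inj₂)
open import Data.Vec using (Vec; lookup) renaming ([] to []ᵥ; _∷_ to _∷ᵥ_)
open import Function using (_∘_; id; _⇔_; mk⇔; Equivalence; Injective)
open import Function.Properties.Equivalence using () renaming (trans to ⇔-trans; sym to ⇔-sym)
open import Relation.Binary.Definitions using (tri<; tri≈; tri>)
open import Relation.Binary.PropositionalEquality using (_≡_; _≢_; refl; sym; trans; cong; cong₂; subst; subst₂; module ≡-Reasoning)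
open import Relation.Nullary using (¬_; Dec; yes; no; does; _×-dec_; ¬?)
open import Relation.Nullary.Decidable using (does-⇔; dec-true; dec-false)

private
  variable
    A B : Set


T-injective : ∀ {a b} → T a ⇔ T b → a ≡ b
T-injective {false} {false} _   = refl
T-injective {false} {true}  a⇔b = ⊥-elim (Equivalence.from a⇔b _)
T-injective {true}  {false} a⇔b = ⊥-elim (Equivalence.to a⇔b _)
T-injective {true}  {true}  _   = refl

¬T⇒≡false : ∀ {b} → ¬ T b → b ≡ false
¬T⇒≡false ¬b = T-injective (mk⇔ (⊥-elim ∘ ¬b) λ ())

T-does : {P : Set} (p? : Dec P) → T (does p?) ⇔ P
T-does (yes p) = mk⇔ (λ _ → p) (λ _ → _)
T-does (no ¬p) = mk⇔ (λ ()) ¬p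

T-not : ∀ {b} → T (not b) ⇔ (¬ T b)
T-not {false} = mk⇔ (λ _ ()) (λ _ → _)
T-not {true}  = mk⇔ (λ ()) (λ ¬true → ¬true _)

T-anyFin : ∀ {n} (f : Fin n → Bool) → T (any f (allFin n)) ⇔ ∃ (T ∘ f)
T-anyFin f = mk⇔ (Any.tabulate⁻ ∘ any⁻ f _) (λ (x , fx) → any⁺ f (Any.tabulate⁺ x fx))

T-allFin : ∀ {n} (f : Fin n → Bool) → T (all f (allFin n)) ⇔ (∀ x → T (f x))
T-allFin f = mk⇔ (All.tabulate⁻ ∘ all⁺ f _) (all⁻ f ∘ All.tabulate⁺)

boolToℕ : Bool → ℕ
boolToℕ false = 0
boolToℕ true  = 1

count : (A → Bool) → List A → ℕ
count p = sum ∘ map (boolToℕ ∘ p)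

length-filterᵇ : (p : A → Bool) (xs : List A) → length (filterᵇ p xs) ≡ count p xs
length-filterᵇ p []       = refl
length-filterᵇ p (x ∷ xs) with p x
... | true  = cong suc (length-filterᵇ p xs)
... | false = length-filterᵇ p xs

count-cong : {p q : A → Bool} → (∀ x → p x ≡ q x) → (xs : List A) → count p xs ≡ count q xs
count-cong p≗q []       = refl
count-cong p≗q (x ∷ xs) = cong₂ _+_ (cong boolToℕ (p≗q x)) (count-cong p≗q xs)

count-none : {p : A → Bool} → (∀ x → ¬ T (p x)) → (xs : List A) → count p xs ≡ 0
count-none             never []       = refl
count-none {p = p} never (x ∷ xs) with p x | never x
... | false | _     = count-none never xs
... | true  | ¬true = ⊥-elim (¬true _)

count-++ : (p : A → Bool) (xs ys : List A) → count p (xs ++ ys) ≡ count p xs + count p ys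
count-++ p xs ys = trans (cong sum (map-++ (boolToℕ ∘ p) xs ys)) (sum-++ (map (boolToℕ ∘ p) xs) _)

count-map : (p : B → Bool) (f : A → B) (xs : List A) → count p (map f xs) ≡ count (p ∘ f) xs
count-map p f xs = cong sum (sym (map-∘ xs))

count-concatMap : (p : B → Bool) (f : A → List B) (xs : List A) →
                  count p (concatMap f xs) ≡ sum (map (count p ∘ f) xs)
count-concatMap p f []       = refl
count-concatMap p f (x ∷ xs) =
  trans (count-++ p (f x) (concatMap f xs)) (cong (count p (f x) +_) (count-concatMap p f xs))

sum-map-+ : (f g : A → ℕ) (xs : List A) →
            sum (map (λ x → f x + g x) xs) ≡ sum (map f xs) + sum (map g xs)
sum-map-+ f g []       = refl
sum-map-+ f g (x ∷ xs) =
  trans (cong (f x + g x +_) (sum-map-+ f g xs)) (+-interchange (f x) (g x) _ _)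

sum-boolToℕ-* : (p : A → Bool) (c : ℕ) (xs : List A) → sum (map (λ x → boolToℕ (p x) * c) xs) ≡ count p xs * c
sum-boolToℕ-* p c []       = refl
sum-boolToℕ-* p c (x ∷ xs) =
  trans (cong (boolToℕ (p x) * c +_) (sum-boolToℕ-* p c xs)) (sym (*-distribʳ-+ c (boolToℕ (p x)) (count p xs)))

count-split : (p q : A → Bool) (xs : List A) →
              count p xs ≡ count (λ x → p x ∧ not (q x)) xs + count (λ x → p x ∧ q x) xs
count-split p q []       = refl
count-split p q (x ∷ xs) =
  trans (cong₂ _+_ (split (p x) (q x)) (count-split p q xs))
        (+-interchange (boolToℕ (p x ∧ not (q x))) (boolToℕ (p x ∧ q x)) _ _)
  where
  split : ∀ a b → boolToℕ a ≡ boolToℕ (a ∧ not b) + boolToℕ (a ∧ b)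
  split true  true  = refl
  split true  false = refl
  split false _     = refl

count-partition : (p : A → Bool) (q : B → A → Bool) (is : List B) (xs : List A) →
                  (∀ x → T (p x) → count (λ i → q i x) is ≡ 1) →
                  count p xs ≡ sum (map (λ i → count (λ x → p x ∧ q i x) xs) is)
count-partition p q is []       _      = sym (count-none (λ _ ()) is)
count-partition p q is (x ∷ xs) unique =
  trans (cong₂ _+_ head (count-partition p q is xs unique))
        (sym (sum-map-+ (λ i → boolToℕ (p x ∧ q i x)) (λ i → count (λ x → p x ∧ q i x) xs) is))
  where
  head : boolToℕ (p x) ≡ count (λ i → p x ∧ q i x) is
  head with p x | unique x
  ... | true  | once = sym (once _)
  ... | false | _    = sym (count-none (λ _ ()) is)

tabulate-∘toℕ : (f : ℕ → A) (n : ℕ) → tabulate {n = n} (f ∘ toℕ) ≡ applyUpTo f n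
tabulate-∘toℕ f zero    = refl
tabulate-∘toℕ f (suc n) = cong (f 0 ∷_) (tabulate-∘toℕ (f ∘ suc) n)

count-allFin : ∀ {n} (p : ℕ → Bool) → count (p ∘ toℕ) (allFin n) ≡ count p (upTo n)
count-allFin {n} p = begin
  count (p ∘ toℕ) (allFin n)   ≡⟨ count-map p toℕ (allFin n) ⟨
  count p (map toℕ (allFin n)) ≡⟨ cong (count p) (map-tabulate {n = n} id toℕ) ⟩
  count p (tabulate {n = n} toℕ) ≡⟨ cong (count p) (tabulate-∘toℕ id n) ⟩
  count p (upTo n)             ∎
  where open ≡-Reasoning

sum-upTo-suc : (f : ℕ → ℕ) (m : ℕ) → sum (map f (upTo (suc m))) ≡ sum (map f (upTo m)) + f m
sum-upTo-suc f m = begin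
  sum (map f (upTo (suc m)))          ≡⟨ cong (sum ∘ map f) (upTo-∷ʳ m) ⟨
  sum (map f (upTo m ∷ʳ m))           ≡⟨ cong sum (map-++ f (upTo m) (m ∷ [])) ⟩
  sum (map f (upTo m) ++ f m ∷ [])    ≡⟨ sum-++ (map f (upTo m)) (f m ∷ []) ⟩
  sum (map f (upTo m)) + (f m + 0)    ≡⟨ cong (sum (map f (upTo m)) +_) (+-identityʳ (f m)) ⟩
  sum (map f (upTo m)) + f m          ∎
  where open ≡-Reasoning


inRange : ℕ → ℕ → ℕ → Bool
inRange lo hi x = does (lo ≤? x ×-dec x <? hi)

T-inRange : ∀ {lo hi x} → T (inRange lo hi x) ⇔ (lo ≤ x × x < hi)
T-inRange {lo} {hi} {x} = T-does (lo ≤? x ×-dec x <? hi)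

T-inRange-suc : ∀ {c x} → T (inRange c (suc c) x) ⇔ x ≡ c
T-inRange-suc = ⇔-trans T-inRange (mk⇔ (λ (c≤x , x≤c) → ≤-antisym (s≤s⁻¹ x≤c) c≤x) (λ { refl → ≤-refl , ≤-refl }))

count-inRange-upTo : ∀ lo hi n → count (inRange lo hi) (upTo n) ≡ n ⊓ hi ∸ lo
count-inRange-upTo lo hi zero    = sym (0∸n≡0 lo)
count-inRange-upTo lo hi (suc n) = begin
  count (inRange lo hi) (upTo (suc n))                           ≡⟨ cong (count (inRange lo hi)) (upTo-∷ʳ n) ⟨
  count (inRange lo hi) (upTo n ∷ʳ n)                            ≡⟨ count-++ (inRange lo hi) (upTo n) (n ∷ []) ⟩
  count (inRange lo hi) (upTo n) + (boolToℕ (inRange lo hi n) + 0) ≡⟨ cong₂ _+_ (count-inRange-upTo lo hi n) (+-identityʳ _) ⟩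
  n ⊓ hi ∸ lo + boolToℕ (inRange lo hi n)                        ≡⟨ last-step ⟩
  suc n ⊓ hi ∸ lo                                                ∎
  where
  open ≡-Reasoning
  range? : Dec (lo ≤ n × n < hi)
  range? = lo ≤? n ×-dec n <? hi
  last-step : n ⊓ hi ∸ lo + boolToℕ (inRange lo hi n) ≡ suc n ⊓ hi ∸ lo
  last-step with n <? hi | lo ≤? n
  ... | no n≮hi | _ rewrite dec-false range? (n≮hi ∘ proj₂)
                          | m≥n⇒m⊓n≡n (≮⇒≥ n≮hi) | m≥n⇒m⊓n≡n (m≤n⇒m≤1+n (≮⇒≥ n≮hi)) = +-identityʳ _
  ... | yes n<hi | yes lo≤n rewrite dec-true range? (lo≤n , n<hi)
                          | m≤n⇒m⊓n≡m (<⇒≤ n<hi) | m≤n⇒m⊓n≡m n<hi = trans (+-comm _ 1) (sym (+-∸-assoc 1 lo≤n))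
  ... | yes n<hi | no lo≰n rewrite dec-false range? (lo≰n ∘ proj₁)
                          | m≤n⇒m⊓n≡m (<⇒≤ n<hi) | m≤n⇒m⊓n≡m n<hi =
    trans (+-identityʳ _) (trans (m≤n⇒m∸n≡0 (<⇒≤ (≰⇒> lo≰n))) (sym (m≤n⇒m∸n≡0 (≰⇒> lo≰n))))

count-≟-upTo : ∀ {c n} → c < n → count (λ i → does (i ≟ c)) (upTo n) ≡ 1
count-≟-upTo {c} {n} c<n = begin
  count (λ i → does (i ≟ c)) (upTo n) ≡⟨ count-cong (λ i → T-injective (⇔-trans (T-does (i ≟ c)) (⇔-sym T-inRange-suc))) (upTo n) ⟩
  count (inRange c (suc c)) (upTo n)  ≡⟨ count-inRange-upTo c (suc c) n ⟩
  n ⊓ suc c ∸ c                       ≡⟨ cong (_∸ c) (m≥n⇒m⊓n≡n c<n) ⟩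
  suc c ∸ c                           ≡⟨ m+n∸n≡m 1 c ⟩
  1                                   ∎
  where open ≡-Reasoning


Letters : ℕ → Set
Letters n = Fin n → Bool

size : ∀ {n} → Letters n → ℕ
size {n} B = count B (allFin n)

interval : ∀ {n} → ℕ → ℕ → Letters n
interval lo hi b = inRange lo hi (toℕ b)

size-interval : ∀ {n lo hi} → hi ≤ n → size {n} (interval lo hi) ≡ hi ∸ lo
size-interval {n} {lo} {hi} hi≤n =
  trans (count-allFin {n} (inRange lo hi)) (trans (count-inRange-upTo lo hi n) (cong (_∸ lo) (m≥n⇒m⊓n≡n hi≤n)))

Disjoint : ∀ {n} → Letters n → Letters n → Set
Disjoint B C = ∀ a → T (B a) → ¬ T (C a)

disjoint-intervals : ∀ {n} lo hi lo′ hi′ → hi ≤ lo′ → Disjoint {n} (interval lo hi) (interval lo′ hi′)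
disjoint-intervals lo hi lo′ hi′ hi≤lo′ a a∈B a∈C =
  <⇒≱ (proj₂ (Equivalence.to (T-inRange {lo} {hi}) a∈B))
      (≤-trans hi≤lo′ (proj₁ (Equivalence.to (T-inRange {lo′} {hi′}) a∈C)))

remove : ∀ {n} → Fin n → Letters n → Letters n
remove a B b = B b ∧ not (does (b ≟ᶠ a))

remove-∉ : ∀ {n} {a : Fin n} {C : Letters n} → ¬ T (C a) → ∀ b → remove a C b ≡ C b
remove-∉ {a = a} {C} a∉C b with b ≟ᶠ a
... | yes refl = trans (∧-zeroʳ (C a)) (sym (¬T⇒≡false a∉C))
... | no  _    = ∧-identityʳ (C b)

remove-⊆ : ∀ {n} {a b : Fin n} (C : Letters n) → T (remove a C b) → T (C b)
remove-⊆ {a = a} {b} C = proj₁ ∘ Equivalence.to (T-∧ {C b})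

size-singleton : ∀ {n} (a : Fin n) → size (λ b → does (b ≟ᶠ a)) ≡ 1
size-singleton {n} a = begin
  size (λ b → does (b ≟ᶠ a))                    ≡⟨ count-cong (λ b → does-⇔ toℕ-≡⇔ (b ≟ᶠ a) (toℕ b ≟ toℕ a)) (allFin n) ⟩
  count (λ b → does (toℕ b ≟ toℕ a)) (allFin n) ≡⟨ count-allFin {n} (λ i → does (i ≟ toℕ a)) ⟩
  count (λ i → does (i ≟ toℕ a)) (upTo n)       ≡⟨ count-≟-upTo (toℕ<n a) ⟩
  1                                             ∎
  where
  open ≡-Reasoning
  toℕ-≡⇔ : ∀ {b} → b ≡ a ⇔ toℕ b ≡ toℕ a
  toℕ-≡⇔ = mk⇔ (cong toℕ) toℕ-injective

size-remove-∈ : ∀ {n} {a : Fin n} (B : Letters n) → T (B a) → size (remove a B) ≡ size B ∸ 1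
size-remove-∈ {n} {a} B a∈B = sym (begin
  size B ∸ 1                                                 ≡⟨ cong (_∸ 1) (count-split B (λ b → does (b ≟ᶠ a)) (allFin n)) ⟩
  size (remove a B) + size (λ b → B b ∧ does (b ≟ᶠ a)) ∸ 1 ≡⟨ cong (λ c → size (remove a B) + c ∸ 1) (count-cong B∩a≡a (allFin n)) ⟩
  size (remove a B) + size (λ b → does (b ≟ᶠ a)) ∸ 1       ≡⟨ cong (λ c → size (remove a B) + c ∸ 1) (size-singleton a) ⟩
  size (remove a B) + 1 ∸ 1                                  ≡⟨ m+n∸n≡m _ 1 ⟩
  size (remove a B)                                          ∎)
  where
  open ≡-Reasoning
  B∩a≡a : ∀ b → B b ∧ does (b ≟ᶠ a) ≡ does (b ≟ᶠ a)
  B∩a≡a b with b ≟ᶠ a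
  ... | yes refl = T-injective (mk⇔ (λ _ → _) (λ _ → Equivalence.from T-∧ (a∈B , _)))
  ... | no  _    = ∧-zeroʳ (B b)


-- Injective words with prescribed letters

-- w is injective and its letter at position x lies in S x. Each letter used is removed from the
-- sets of the later positions, so that counting can follow the recursion on w.
fitsInjectively : ∀ {n m} → (ℕ → Letters n) → Vec (Fin n) m → Bool
fitsInjectively S []ᵥ      = true
fitsInjectively S (a ∷ᵥ w) = S 0 a ∧ fitsInjectively (λ x → remove a (S (suc x))) w

fitsInjectively-cong : ∀ {n m} {S S′ : ℕ → Letters n} → (∀ x b → S x b ≡ S′ x b) →
                       (w : Vec (Fin n) m) → fitsInjectively S w ≡ fitsInjectively S′ w
fitsInjectively-cong S≗S′ []ᵥ      = refl
fitsInjectively-cong S≗S′ (a ∷ᵥ w) =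
  cong₂ _∧_ (S≗S′ 0 a) (fitsInjectively-cong (λ x b → cong (_∧ _) (S≗S′ (suc x) b)) w)

T-fitsInjectively : ∀ {n m} (S : ℕ → Letters n) (w : Vec (Fin n) m) →
                    T (fitsInjectively S w) ⇔
                    ((∀ x → T (S (toℕ x) (lookup w x))) × Injective _≡_ _≡_ (lookup w))
T-fitsInjectively S []ᵥ      = mk⇔ (λ _ → (λ ()) , λ { {()} })  (λ _ → _)
T-fitsInjectively {n} S (a ∷ᵥ w) = mk⇔ to from
  where
  S′ : ℕ → Letters n
  S′ x = remove a (S (suc x))
  T-remove : ∀ {x b} → T (S′ x b) ⇔ (T (S (suc x) b) × b ≢ a)
  T-remove {x} {b} = mk⇔
    (λ h → let (b∈ , b≢a) = Equivalence.to T-∧ h in b∈ , Equivalence.to (T-does (¬? (b ≟ᶠ a))) b≢a)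
    (λ (b∈ , b≢a) → Equivalence.from T-∧ (b∈ , Equivalence.from (T-does (¬? (b ≟ᶠ a))) b≢a))
  to : T (fitsInjectively S (a ∷ᵥ w)) →
       (∀ x → T (S (toℕ x) (lookup (a ∷ᵥ w) x))) × Injective _≡_ _≡_ (lookup (a ∷ᵥ w))
  to h = member , injective
    where
    a∈ : T (S 0 a)
    a∈ = proj₁ (Equivalence.to T-∧ h)
    tail : (∀ x → T (S′ (toℕ x) (lookup w x))) × Injective _≡_ _≡_ (lookup w)
    tail = Equivalence.to (T-fitsInjectively S′ w) (proj₂ (Equivalence.to (T-∧ {S 0 a}) h))
    member : ∀ x → T (S (toℕ x) (lookup (a ∷ᵥ w) x))
    member zero    = a∈
    member (suc x) = proj₁ (Equivalence.to T-remove (proj₁ tail x))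
    injective : Injective _≡_ _≡_ (lookup (a ∷ᵥ w))
    injective {zero}  {zero}  _  = refl
    injective {zero}  {suc y} eq = ⊥-elim (proj₂ (Equivalence.to T-remove (proj₁ tail y)) (sym eq))
    injective {suc x} {zero}  eq = ⊥-elim (proj₂ (Equivalence.to T-remove (proj₁ tail x)) eq)
    injective {suc x} {suc y} eq = cong suc (proj₂ tail eq)
  from : (∀ x → T (S (toℕ x) (lookup (a ∷ᵥ w) x))) × Injective _≡_ _≡_ (lookup (a ∷ᵥ w)) →
         T (fitsInjectively S (a ∷ᵥ w))
  from (member , injective) = Equivalence.from T-∧ (member zero ,
    Equivalence.from (T-fitsInjectively S′ w)
      ( (λ x → Equivalence.from T-remove (member (suc x) , λ eq → 0≢suc (injective (sym eq))))
      , (λ eq → Fin-suc-injective (injective eq))))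
    where
    0≢suc : ∀ {k} {x : Fin k} → Fin.zero ≢ suc x
    0≢suc ()

count-allWords-suc : ∀ {n m} (p : Vec (Fin n) (suc m) → Bool) →
                     count p (allWords n (suc m)) ≡ sum (map (λ a → count (p ∘ (a ∷ᵥ_)) (allWords n m)) (allFin n))
count-allWords-suc {n} {m} p = trans (count-concatMap p (λ a → map (a ∷ᵥ_) (allWords n m)) (allFin n))
  (cong sum (map-cong (λ a → count-map p (a ∷ᵥ_) (allWords n m)) (allFin n)))

Blocks : ℕ → Set
Blocks n = List (Letters n × ℕ)

lettersAt : ∀ {n} → Blocks n → ℕ → Letters n
lettersAt []             x = λ _ → false
lettersAt ((B , k) ∷ bs) x = if x <ᵇ k then B else lettersAt bs (x ∸ k)

lettersAt-∷-< : ∀ {n} {B : Letters n} {k x} bs → x < k → lettersAt ((B , k) ∷ bs) x ≡ B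
lettersAt-∷-< {k = k} {x} bs x<k rewrite Equivalence.to T-≡ (<⇒<ᵇ x<k) = refl

lettersAt-∷-≥ : ∀ {n} {B : Letters n} {k x} bs → k ≤ x → lettersAt ((B , k) ∷ bs) x ≡ lettersAt bs (x ∸ k)
lettersAt-∷-≥ {k = k} {x} bs k≤x rewrite ¬T⇒≡false (≤⇒≯ k≤x ∘ <ᵇ⇒< x k) = refl

blocksLength : ∀ {n} → Blocks n → ℕ
blocksLength = sum ∘ map proj₂

DisjointBlocks : ∀ {n} → Blocks n → Set
DisjointBlocks = AllPairs (λ b c → Disjoint (proj₁ b) (proj₁ c))

fallingFactorial : ℕ → ℕ → ℕ
fallingFactorial s zero    = 1
fallingFactorial s (suc k) = s * fallingFactorial (s ∸ 1) k

fallingFactorial-! : ∀ k → fallingFactorial k k ≡ k !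
fallingFactorial-! zero    = refl
fallingFactorial-! (suc k) = cong (suc k *_) (fallingFactorial-! k)

blockCount : ∀ {n} → Letters n × ℕ → ℕ
blockCount (B , k) = fallingFactorial (size B) k

blocksCount : ∀ {n} → Blocks n → ℕ
blocksCount = product ∘ map blockCount

removeFromBlocks : ∀ {n} → Fin n → Blocks n → Blocks n
removeFromBlocks a = map (map₁ (remove a))

lettersAt-removeFromBlocks : ∀ {n} (a : Fin n) bs x b →
                             remove a (lettersAt bs x) b ≡ lettersAt (removeFromBlocks a bs) x b
lettersAt-removeFromBlocks a []             x b = refl
lettersAt-removeFromBlocks a ((B , k) ∷ bs) x b with x <ᵇ k
... | true  = refl
... | false = lettersAt-removeFromBlocks a bs (x ∸ k) b

blocksLength-removeFromBlocks : ∀ {n} (a : Fin n) bs → blocksLength (removeFromBlocks a bs) ≡ blocksLength bs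
blocksLength-removeFromBlocks a bs = cong sum (sym (map-∘ bs))

disjointBlocks-removeFromBlocks : ∀ {n} (a : Fin n) {bs} → DisjointBlocks bs → DisjointBlocks (removeFromBlocks a bs)
disjointBlocks-removeFromBlocks a = AllPairs.map⁺ ∘ AllPairs.map
  (λ {(B , _)} {(C , _)} B∩C=∅ b b∈B′ b∈C′ → B∩C=∅ b (remove-⊆ B b∈B′) (remove-⊆ C b∈C′))

blocksCount-removeFromBlocks : ∀ {n} {a : Fin n} bs → All (λ c → ¬ T (proj₁ c a)) bs →
                               blocksCount (removeFromBlocks a bs) ≡ blocksCount bs
blocksCount-removeFromBlocks {n} {a} bs a∉bs =
  cong product (trans (sym (map-∘ bs)) (map-cong-local (All.map (λ {c} → unchanged c) a∉bs)))
  where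
  unchanged : ∀ c → ¬ T (proj₁ c a) → blockCount (map₁ (remove a) c) ≡ blockCount c
  unchanged (C , k) a∉C = cong (λ s → fallingFactorial s k) (count-cong (remove-∉ a∉C) (allFin n))

-- Each choice of a first letter a ∈ B leaves the same problem for the tail, with a removed from
-- every block; disjointness makes a lie in no later block.
count-fitsInjectively : ∀ {n} m (bs : Blocks n) → blocksLength bs ≡ m → DisjointBlocks bs →
                        count (fitsInjectively (lettersAt bs)) (allWords n m) ≡ blocksCount bs
count-fitsInjectively zero    []                   _   _ = refl
count-fitsInjectively (suc m) []                   ()  _
count-fitsInjectively m       ((B , zero) ∷ bs)    len (_ ∷ disj) =
  trans (count-fitsInjectively m bs len disj) (sym (+-identityʳ _))
count-fitsInjectively zero    ((B , suc k) ∷ bs)   ()  _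
count-fitsInjectively {n} (suc m) ((B , suc k) ∷ bs) len (B∩bs=∅ ∷ disj) = begin
  count (fitsInjectively (lettersAt ((B , suc k) ∷ bs))) (allWords n (suc m))
    ≡⟨ count-allWords-suc {n} {m} _ ⟩
  sum (map (λ a → count (λ w → fitsInjectively (lettersAt ((B , suc k) ∷ bs)) (a ∷ᵥ w)) (allWords n m)) (allFin n))
    ≡⟨ cong sum (map-cong first-letter (allFin n)) ⟩
  sum (map (λ a → boolToℕ (B a) * rest) (allFin n))
    ≡⟨ sum-boolToℕ-* B rest (allFin n) ⟩
  size B * rest
    ≡⟨ *-assoc (size B) _ _ ⟨
  blocksCount ((B , suc k) ∷ bs)
    ∎
  where
  open ≡-Reasoning
  rest : ℕ
  rest = fallingFactorial (size B ∸ 1) k * blocksCount bs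
  first-letter : ∀ a → count (λ w → fitsInjectively (lettersAt ((B , suc k) ∷ bs)) (a ∷ᵥ w)) (allWords n m)
                     ≡ boolToℕ (B a) * rest
  first-letter a with B a in a∈B
  ... | false = count-none (λ _ ()) (allWords n m)
  ... | true  = begin
    count (fitsInjectively (λ x → remove a (lettersAt ((B , k) ∷ bs) x))) (allWords n m)
      ≡⟨ count-cong (fitsInjectively-cong (lettersAt-removeFromBlocks a ((B , k) ∷ bs))) (allWords n m) ⟩
    count (fitsInjectively (lettersAt (removeFromBlocks a ((B , k) ∷ bs)))) (allWords n m)
      ≡⟨ count-fitsInjectively m (removeFromBlocks a ((B , k) ∷ bs))
           (trans (blocksLength-removeFromBlocks a ((B , k) ∷ bs)) (suc-injective len))
           (disjointBlocks-removeFromBlocks a (B∩bs=∅ ∷ disj)) ⟩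
    fallingFactorial (size (remove a B)) k * blocksCount (removeFromBlocks a bs)
      ≡⟨ cong₂ (λ s c → fallingFactorial s k * c) (size-remove-∈ B a∈B′)
               (blocksCount-removeFromBlocks bs (All.map (λ B∩C=∅ → B∩C=∅ a a∈B′) B∩bs=∅)) ⟩
    rest
      ≡⟨ +-identityʳ rest ⟨
    1 * rest ∎
    where
    a∈B′ : T (B a)
    a∈B′ = Equivalence.from T-≡ a∈B


injective⇒≤-width : ∀ {m lo hi} (f : Fin m → ℕ) → Injective _≡_ _≡_ f →
                     (∀ x → lo ≤ f x × f x < hi) → m ≤ hi ∸ lo
injective⇒≤-width {m} {lo} {hi} f f-inj bounds = injective⇒≤ shifted-injective
  where
  shift< : ∀ x → f x ∸ lo < hi ∸ lo
  shift< x = ∸-monoˡ-< (proj₂ (bounds x)) (proj₁ (bounds x))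
  shifted : Fin m → Fin (hi ∸ lo)
  shifted x = fromℕ< (shift< x)
  shifted-injective : Injective _≡_ _≡_ shifted
  shifted-injective {x} {y} eq = f-inj (∸-cancelʳ-≡ (proj₁ (bounds x)) (proj₁ (bounds y))
    (trans (sym (toℕ-fromℕ< (shift< x))) (trans (cong toℕ eq) (toℕ-fromℕ< (shift< y)))))

injective⇒≤-width-on : ∀ {n a b lo hi} (f : Fin n → ℕ) → Injective _≡_ _≡_ f → b ≤ n →
                        (∀ x → a ≤ toℕ x → toℕ x < b → lo ≤ f x × f x < hi) → b ∸ a ≤ hi ∸ lo
injective⇒≤-width-on {n} {a} {b} {lo} {hi} f f-inj b≤n bounds with a ≤? b
... | no  a≰b = subst (_≤ hi ∸ lo) (sym (m≤n⇒m∸n≡0 (<⇒≤ (≰⇒> a≰b)))) z≤n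
... | yes a≤b = injective⇒≤-width (f ∘ embed) (embed-injective ∘ f-inj)
                  (λ k → bounds (embed k) (a≤embed k) (embed<b k))
  where
  a+k<b : ∀ (k : Fin (b ∸ a)) → a + toℕ k < b
  a+k<b k = subst (a + toℕ k <_) (m+[n∸m]≡n a≤b) (+-monoʳ-< a (toℕ<n k))
  embed : Fin (b ∸ a) → Fin n
  embed k = fromℕ< (≤-trans (a+k<b k) b≤n)
  toℕ-embed : ∀ k → toℕ (embed k) ≡ a + toℕ k
  toℕ-embed k = toℕ-fromℕ< (≤-trans (a+k<b k) b≤n)
  a≤embed : ∀ k → a ≤ toℕ (embed k)
  a≤embed k = subst (a ≤_) (sym (toℕ-embed k)) (m≤m+n a _)
  embed<b : ∀ k → toℕ (embed k) < b
  embed<b k = subst (_< b) (sym (toℕ-embed k)) (a+k<b k)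
  embed-injective : Injective _≡_ _≡_ embed
  embed-injective {k} {l} eq = toℕ-injective (+-cancelˡ-≡ a _ _
    (trans (sym (toℕ-embed k)) (trans (cong toℕ eq) (toℕ-embed l))))

argmax-below : ∀ {n J} (f : Fin n → ℕ) → 0 < J → J ≤ n →
               ∃ λ a → toℕ a < J × (∀ x → toℕ x < J → f x ≤ f a)
argmax-below {n} {J} f 0<J J≤n = a , argmax-all f d<J (all-filter below? (allFin n)) , maximal
  where
  below? : (x : Fin n) → Dec (toℕ x < J)
  below? x = toℕ x <? J
  prefix : List (Fin n)
  prefix = filter below? (allFin n)
  d : Fin n
  d = fromℕ< (≤-trans 0<J J≤n)
  d<J : toℕ d < J
  d<J = subst (_< J) (sym (toℕ-fromℕ< (≤-trans 0<J J≤n))) 0<J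
  a : Fin n
  a = argmax f d prefix
  maximal : ∀ x → toℕ x < J → f x ≤ f a
  maximal x x<J = All.lookup (f[xs]≤f[argmax] d prefix) (∈-filter⁺ below? (∈-allFin x) x<J)


-- Permutations and the position of n

value : ∀ {n} → Vec (Fin n) n → Fin n → ℕ
value π x = toℕ (lookup π x)

T-isPerm : ∀ {n} (π : Vec (Fin n) n) → T (isPerm π) ⇔ Injective _≡_ _≡_ (lookup π)
T-isPerm {n} π = mk⇔ to from
  where
  distinct? : Fin n → Fin n → Bool
  distinct? x y = not (val π x ≡ᵇ val π y) ∨ (pos x ≡ᵇ pos y)
  to : T (isPerm π) → Injective _≡_ _≡_ (lookup π)
  to h {x} {y} eq with Equivalence.to T-∨ (Equivalence.to (T-allFin (distinct? x)) (Equivalence.to (T-allFin _) h x) y)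
  ... | inj₁ values-differ = ⊥-elim (Equivalence.to (T-does (¬? (val π x ≟ val π y))) values-differ (cong (suc ∘ toℕ) eq))
  ... | inj₂ same-position = toℕ-injective (suc-injective (≡ᵇ⇒≡ _ _ same-position))
  from : Injective _≡_ _≡_ (lookup π) → T (isPerm π)
  from inj = Equivalence.from (T-allFin _) λ x → Equivalence.from (T-allFin _) λ y →
    Equivalence.from T-∨ (decide x y)
    where
    decide : ∀ x y → T (not (val π x ≡ᵇ val π y)) ⊎ T (pos x ≡ᵇ pos y)
    decide x y with val π x ≟ val π y
    ... | yes eq = inj₂ (≡⇒≡ᵇ (pos x) (pos y) (cong pos (inj (toℕ-injective (suc-injective eq)))))
    ... | no neq = inj₁ (Equivalence.from (T-does (¬? (val π x ≟ val π y))) neq)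

countPerms≡count : ∀ n (P : Vec (Fin n) n → Bool) → countPerms n P ≡ count (λ π → isPerm π ∧ P π) (allWords n n)
countPerms≡count n P = length-filterᵇ (λ π → isPerm π ∧ P π) (allWords n n)

count-isPerm : ∀ n → count isPerm (allWords n n) ≡ n !
count-isPerm n = begin
  count isPerm (allWords n n)
    ≡⟨ count-cong (λ π → T-injective (⇔-trans (T-isPerm π) (perm⇔fits π))) (allWords n n) ⟩
  count (fitsInjectively (lettersAt everything)) (allWords n n)
    ≡⟨ count-fitsInjectively n everything (+-identityʳ n) ([] ∷ []) ⟩
  fallingFactorial (size {n} (interval 0 n)) n * 1
    ≡⟨ cong (λ s → fallingFactorial s n * 1) (size-interval {lo = 0} ≤-refl) ⟩
  fallingFactorial n n * 1
    ≡⟨ trans (*-identityʳ _) (fallingFactorial-! n) ⟩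
  n ! ∎
  where
  open ≡-Reasoning
  everything : Blocks n
  everything = (interval 0 n , n) ∷ []
  perm⇔fits : ∀ π → Injective _≡_ _≡_ (lookup π) ⇔ T (fitsInjectively (lettersAt everything) π)
  perm⇔fits π = ⇔-trans (mk⇔ (λ inj → member , inj) proj₂) (⇔-sym (T-fitsInjectively _ π))
    where
    member : ∀ x → T (lettersAt everything (toℕ x) (lookup π x))
    member x = subst (λ S → T (S (lookup π x))) (sym (lettersAt-∷-< [] (toℕ<n x)))
                     (Equivalence.from (T-inRange {0} {n}) (z≤n , toℕ<n (lookup π x)))

position-of-maximum : ∀ {m} (π : Vec (Fin (suc m)) (suc m)) → Injective _≡_ _≡_ (lookup π) →
                      ∃ λ x → value π x ≡ m
position-of-maximum {m} π inj with injective⇒existsPivot inj (fromℕ m)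
... | x , _ , m≤πx = x , ≤-antisym (s≤s⁻¹ (toℕ<n (lookup π x))) (subst (_≤ value π x) (toℕ-fromℕ m) m≤πx)

T-≡ᵇ-∧-≡ᵇ : ∀ {a b c d} → T ((a ≡ᵇ b) ∧ (c ≡ᵇ d)) ⇔ (a ≡ b × c ≡ d)
T-≡ᵇ-∧-≡ᵇ {a} {b} {c} {d} = mk⇔ (Product.map (≡ᵇ⇒≡ a b) (≡ᵇ⇒≡ c d) ∘ Equivalence.to T-∧)
                                (Equivalence.from T-∧ ∘ Product.map (≡⇒≡ᵇ a b) (≡⇒≡ᵇ c d))

T-nHasRight : ∀ {n} i (π : Vec (Fin n) n) → T (nHasRight i π) ⇔ ∃ λ x → pos x ≡ n ∸ i × val π x ≡ n
T-nHasRight i π = mk⇔ (Product.map₂ (Equivalence.to T-≡ᵇ-∧-≡ᵇ) ∘ Equivalence.to (T-anyFin _))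
                      (Equivalence.from (T-anyFin _) ∘ Product.map₂ (Equivalence.from T-≡ᵇ-∧-≡ᵇ))

suc≡∸⇔≡∸suc : ∀ {t n i} → t < n → suc t ≡ n ∸ i ⇔ i ≡ n ∸ suc t
suc≡∸⇔≡∸suc {t} {n} {i} t<n = mk⇔ to (λ { refl → sym (m∸[m∸n]≡n t<n) })
  where
  to : suc t ≡ n ∸ i → i ≡ n ∸ suc t
  to eq with i ≤? n
  ... | yes i≤n = sym (trans (cong (n ∸_) eq) (m∸[m∸n]≡n i≤n))
  ... | no  i≰n = ⊥-elim (1+n≢0 (trans eq (m≤n⇒m∸n≡0 (<⇒≤ (≰⇒> i≰n)))))

count-nHasRight : ∀ {m} (π : Vec (Fin (suc m)) (suc m)) → Injective _≡_ _≡_ (lookup π) →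
                  count (λ i → nHasRight i π) (upTo (suc m)) ≡ 1
count-nHasRight {m} π inj = trans (count-cong (λ i → T-injective (nHasRight⇔ i)) (upTo (suc m)))
                                   (count-≟-upTo (s≤s (m∸n≤m m (toℕ x₀))))
  where
  x₀ : Fin (suc m)
  x₀ = proj₁ (position-of-maximum π inj)
  πx₀≡m : value π x₀ ≡ m
  πx₀≡m = proj₂ (position-of-maximum π inj)
  at-x₀ : ∀ i → (∃ λ x → pos x ≡ suc m ∸ i × val π x ≡ suc m) ⇔ pos x₀ ≡ suc m ∸ i
  at-x₀ i = mk⇔ (λ (x , px , πx) → subst (λ y → pos y ≡ suc m ∸ i)
                   (inj (toℕ-injective (trans (suc-injective πx) (sym πx₀≡m)))) px)
                (λ px₀ → x₀ , px₀ , cong suc πx₀≡m)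
  nHasRight⇔ : ∀ i → T (nHasRight i π) ⇔ T (does (i ≟ m ∸ toℕ x₀))
  nHasRight⇔ i = ⇔-trans (T-nHasRight i π) (⇔-trans (at-x₀ i)
                  (⇔-trans (suc≡∸⇔≡∸suc (toℕ<n x₀)) (⇔-sym (T-does (i ≟ m ∸ toℕ x₀)))))

countPerms-not+sum≡! : ∀ m (P : Vec (Fin (suc m)) (suc m) → Bool) →
                 countPerms (suc m) (not ∘ P) + sum (map (λ i → countPerms (suc m) (λ π → nHasRight i π ∧ P π)) (upTo (suc m)))
                 ≡ suc m !
countPerms-not+sum≡! m P = begin
  countPerms n (not ∘ P) + sum (map (λ i → countPerms n (λ π → nHasRight i π ∧ P π)) (upTo n))
    ≡⟨ cong₂ _+_ (countPerms≡count n _)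
               (cong sum (map-cong (λ i → trans (countPerms≡count n _) (count-cong (reassoc i) W)) (upTo n))) ⟩
  count (λ π → isPerm π ∧ not (P π)) W + sum (map (λ i → count (λ π → (isPerm π ∧ P π) ∧ nHasRight i π) W) (upTo n))
    ≡⟨ cong (count (λ π → isPerm π ∧ not (P π)) W +_)
            (count-partition (λ π → isPerm π ∧ P π) nHasRight (upTo n) W unique) ⟨
  count (λ π → isPerm π ∧ not (P π)) W + count (λ π → isPerm π ∧ P π) W
    ≡⟨ count-split isPerm P W ⟨
  count isPerm W
    ≡⟨ count-isPerm n ⟩
  n ! ∎
  where
  open ≡-Reasoning
  n : ℕ
  n = suc m
  W : List (Vec (Fin n) n)
  W = allWords n n
  reassoc : ∀ i π → isPerm π ∧ (nHasRight i π ∧ P π) ≡ (isPerm π ∧ P π) ∧ nHasRight i π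
  reassoc i π = trans (cong (isPerm π ∧_) (∧-comm (nHasRight i π) (P π))) (sym (∧-assoc (isPerm π) (P π) (nHasRight i π)))
  unique : ∀ π → T (isPerm π ∧ P π) → count (λ i → nHasRight i π) (upTo n) ≡ 1
  unique π h = count-nHasRight π (Equivalence.to (T-isPerm π) (proj₁ (Equivalence.to T-∧ h)))


-- Occurrences of mesh patterns of length 2

T-between : ∀ {a m b} → T (between a m b) ⇔ (a < m × m < b)
T-between {a} {m} {b} = mk⇔ (Product.map (<ᵇ⇒< a m) (<ᵇ⇒< m b) ∘ Equivalence.to T-∧)
                            (Equivalence.from T-∧ ∘ Product.map <⇒<ᵇ <⇒<ᵇ)

InBox : ∀ {n} → Vec (Fin n) n → Fin n → Fin n → ℕ × ℕ → Fin n → Set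
InBox {n} π i j (a , b) x =
  (P a < pos x × pos x < P (suc a)) × (V b < val π x × val π x < V (suc b))
  where
  P V : ℕ → ℕ
  P = bound n (pos i) (pos j)
  V = bound n (val π i) (val π j)

Occurrence : ∀ {n} → List (ℕ × ℕ) → Vec (Fin n) n → Fin n → Fin n → Set
Occurrence R π i j = pos i < pos j × val π i < val π j × All (λ box → ∀ x → ¬ InBox π i j box x) R

-- contains12 tests the boxes by an anonymous pattern lambda, which is reachable only through
-- its values emptyBox? (a , b).
T-occurrence : ∀ {n} R (π : Vec (Fin n) n) i j (emptyBox? : ℕ × ℕ → Bool) →
               (∀ a b → T (emptyBox? (a , b)) ⇔ (∀ x → ¬ InBox π i j (a , b) x)) →
               T ((pos i <ᵇ pos j) ∧ (val π i <ᵇ val π j) ∧ all emptyBox? R) ⇔ Occurrence R π i j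
T-occurrence R π i j emptyBox? T-emptyBox = mk⇔
  (Product.map (<ᵇ⇒< _ _) (Product.map (<ᵇ⇒< _ _) (All.map (λ {(a , b)} → Equivalence.to (T-emptyBox a b)) ∘ all⁺ _ R)
                            ∘ Equivalence.to T-∧) ∘ Equivalence.to T-∧)
  (Equivalence.from T-∧ ∘ Product.map <⇒<ᵇ (Equivalence.from T-∧ ∘ Product.map <⇒<ᵇ
                            (all⁻ _ ∘ All.map (λ {(a , b)} → Equivalence.from (T-emptyBox a b)))))

T-contains12 : ∀ {n} R (π : Vec (Fin n) n) → T (contains12 R π) ⇔ ∃₂ (Occurrence R π)
T-contains12 {n} R π = mk⇔
  (λ h → Product.map₂ (λ {i} h′ → Product.map₂ (λ {j} → Equivalence.to (T-occurrenceAt i j)) (Equivalence.to (T-anyFin _) h′))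
                      (Equivalence.to (T-anyFin _) h))
  (λ (i , j , occ) → Equivalence.from (T-anyFin _) (i , Equivalence.from (T-anyFin _) (j , Equivalence.from (T-occurrenceAt i j) occ)))
  where
  inBox? : Fin n → Fin n → ℕ → ℕ → Fin n → Bool
  inBox? i j a b x = between (bound n (pos i) (pos j) a) (pos x) (bound n (pos i) (pos j) (suc a)) ∧
                     between (bound n (val π i) (val π j) b) (val π x) (bound n (val π i) (val π j) (suc b))
  T-inBox : ∀ {i j a b x} → T (inBox? i j a b x) ⇔ InBox π i j (a , b) x
  T-inBox = mk⇔ (Product.map (Equivalence.to T-between) (Equivalence.to T-between) ∘ Equivalence.to T-∧)
                (Equivalence.from T-∧ ∘ Product.map (Equivalence.from T-between) (Equivalence.from T-between))
  T-emptyBox : ∀ i j a b → T (not (any (inBox? i j a b) (allFin n))) ⇔ (∀ x → ¬ InBox π i j (a , b) x)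
  T-emptyBox i j a b = mk⇔
    (λ h x inBox → Equivalence.to T-not h (Equivalence.from (T-anyFin _) (x , Equivalence.from (T-inBox {x = x}) inBox)))
    (λ empty → Equivalence.from T-not (λ h → let (x , x∈box) = Equivalence.to (T-anyFin (inBox? i j a b)) h
                                           in empty x (Equivalence.to T-inBox x∈box)))
  T-occurrenceAt : ∀ i j → T ((pos i <ᵇ pos j) ∧ (val π i <ᵇ val π j) ∧
                             all (λ box → not (any (inBox? i j (proj₁ box) (proj₂ box)) (allFin n))) R)
                          ⇔ Occurrence R π i j
  T-occurrenceAt i j = T-occurrence R π i j _ (T-emptyBox i j)


-- Occurrences of p

module _ {n} (π : Vec (Fin n) n) (inj : Injective _≡_ _≡_ (lookup π)) where

  value-injective : ∀ {x y} → value π x ≡ value π y → x ≡ y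
  value-injective = inj ∘ toℕ-injective

  occurrence-before : ∀ {i j} → Occurrence shadingP π i j →
                      ∀ x → toℕ x < toℕ j → value π x ≤ value π i
  occurrence-before {i} {j} (_ , _ , e01 ∷ e02 ∷ e11 ∷ e12 ∷ _) x x<j
    with <-cmp (value π x) (value π i)
  ... | tri< πx<πi _ _ = <⇒≤ πx<πi
  ... | tri≈ _ πx≡πi _ = ≤-reflexive πx≡πi
  ... | tri> _ πx≢πi πi<πx with <-cmp (value π x) (value π j) | <-cmp (toℕ x) (toℕ i)
  ...   | tri≈ _ πx≡πj _ | _              = ⊥-elim (<-irrefl (cong toℕ (value-injective πx≡πj)) x<j)
  ...   | _              | tri≈ _ x≡i _   = ⊥-elim (πx≢πi (cong (value π) (toℕ-injective x≡i)))
  ...   | tri< πx<πj _ _ | tri< x<i _ _   = ⊥-elim (e01 x ((z<s , s<s x<i) , (s<s πi<πx , s<s πx<πj)))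
  ...   | tri< πx<πj _ _ | tri> _ _ i<x   = ⊥-elim (e11 x ((s<s i<x , s<s x<j) , (s<s πi<πx , s<s πx<πj)))
  ...   | tri> _ _ πj<πx | tri< x<i _ _   = ⊥-elim (e02 x ((z<s , s<s x<i) , (s<s πj<πx , s<s (toℕ<n _))))
  ...   | tri> _ _ πj<πx | tri> _ _ i<x   = ⊥-elim (e12 x ((s<s i<x , s<s x<j) , (s<s πj<πx , s<s (toℕ<n _))))

  occurrence-after : ∀ {i j} → Occurrence shadingP π i j →
                     ∀ x → toℕ j < toℕ x → value π i < value π x × value π x < value π j
  occurrence-after {i} {j} (i<j , _ , _ ∷ _ ∷ _ ∷ _ ∷ e20 ∷ e22 ∷ []) x j<x = above-i , below-j
    where
    above-i : value π i < value π x
    above-i with <-cmp (value π x) (value π i)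
    ... | tri< πx<πi _ _ = ⊥-elim (e20 x ((s<s j<x , s<s (toℕ<n x)) , (z<s , s<s πx<πi)))
    ... | tri≈ _ πx≡πi _ = ⊥-elim (<-asym (s<s⁻¹ i<j) (subst (λ y → toℕ j < toℕ y) (value-injective πx≡πi) j<x))
    ... | tri> _ _ πi<πx = πi<πx
    below-j : value π x < value π j
    below-j with <-cmp (value π x) (value π j)
    ... | tri< πx<πj _ _ = πx<πj
    ... | tri≈ _ πx≡πj _ = ⊥-elim (<-irrefl (cong toℕ (sym (value-injective πx≡πj))) j<x)
    ... | tri> _ _ πj<πx = ⊥-elim (e22 x ((s<s j<x , s<s (toℕ<n x)) , (s<s πj<πx , s<s (toℕ<n _))))

-- π = σ (J + k) τ in 0-based letters, with σ a permutation of {0, …, J − 1} and τ one of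
-- {J, …, J + k − 1}.
SplitLetter : (J k p b : ℕ) → Set
SplitLetter J k p b = (p < J → b < J) × (p ≡ J → b ≡ J + k) × (J < p → J ≤ b × b < J + k)

Split : ∀ J k → Vec (Fin (suc (J + k))) (suc (J + k)) → Set
Split J k π = ∀ x → SplitLetter J k (toℕ x) (value π x)

module _ {J k} (π : Vec (Fin (suc (J + k))) (suc (J + k))) (inj : Injective _≡_ _≡_ (lookup π))
         {i j} (occ : Occurrence shadingP π i j) where

  private
    πi<πj : value π i < value π j
    πi<πj = s<s⁻¹ (proj₁ (proj₂ occ))

  occurrence-at-maximum : value π j ≡ J + k
  occurrence-at-maximum = ≤-antisym (s≤s⁻¹ (toℕ<n (lookup π j)))
                                    (subst (_≤ value π j) (proj₂ (position-of-maximum π inj)) (bounded-by-j _))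
    where
    bounded-by-j : ∀ x → value π x ≤ value π j
    bounded-by-j x with <-cmp (toℕ x) (toℕ j)
    ... | tri< x<j _ _ = <⇒≤ (≤-<-trans (occurrence-before π inj occ x x<j) πi<πj)
    ... | tri≈ _ x≡j _ = ≤-reflexive (cong (value π) (toℕ-injective x≡j))
    ... | tri> _ _ j<x = <⇒≤ (proj₂ (occurrence-after π inj occ x j<x))

  occurrence-position : T (nHasRight k π) → toℕ j ≡ J
  occurrence-position nAtJ with Equivalence.to (T-nHasRight k π) nAtJ
  ... | y , posy , valy = suc-injective (begin
    suc (toℕ j)     ≡⟨ cong pos (value-injective π inj (trans (suc-injective valy) (sym occurrence-at-maximum))) ⟨
    pos y           ≡⟨ posy ⟩
    suc (J + k) ∸ k ≡⟨ m+n∸n≡m (suc J) k ⟩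
    suc J           ∎)
    where open ≡-Reasoning

  occurrence⇒split : T (nHasRight k π) → Split J k π
  occurrence⇒split nAtJ x = before-J , at-J , after-J
    where
    j≡J : toℕ j ≡ J
    j≡J = occurrence-position nAtJ
    -- Pigeonhole on both sides of j: the J letters before it are ≤ π_i, the ones from it on are > π_i.
    J≤1+πi : J ≤ suc (value π i)
    J≤1+πi = injective⇒≤-width-on {a = 0} (value π) (value-injective π inj) (≤-trans (m≤m+n J k) (n≤1+n _))
      (λ x _ x<J → z≤n , s≤s (occurrence-before π inj occ x (subst (toℕ x <_) (sym j≡J) x<J)))
    1+πi≤J : suc (value π i) ≤ J
    1+πi≤J = ≮⇒≥ (λ J<1+πi → <⇒≱ (∸-monoʳ-< J<1+πi (toℕ<n (lookup π i)))
      (injective⇒≤-width-on (value π) (value-injective π inj) ≤-refl suffix-bounds))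
      where
      suffix-bounds : ∀ x → J ≤ toℕ x → toℕ x < suc (J + k) → suc (value π i) ≤ value π x × value π x < suc (J + k)
      suffix-bounds x J≤x _ with <-cmp (toℕ j) (toℕ x)
      ... | tri< j<x _ _ = proj₁ (occurrence-after π inj occ x j<x) , toℕ<n _
      ... | tri≈ _ j≡x _ = subst (λ y → value π i < value π y) (toℕ-injective j≡x) πi<πj , toℕ<n _
      ... | tri> _ _ x<j = ⊥-elim (<⇒≱ (subst (toℕ x <_) j≡J x<j) J≤x)
    before-J : toℕ x < J → value π x < J
    before-J x<J = ≤-<-trans (occurrence-before π inj occ x (subst (toℕ x <_) (sym j≡J) x<J)) 1+πi≤J
    at-J : toℕ x ≡ J → value π x ≡ J + k
    at-J x≡J = trans (cong (value π) (toℕ-injective (trans x≡J (sym j≡J)))) occurrence-at-maximum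
    after-J : J < toℕ x → J ≤ value π x × value π x < J + k
    after-J J<x = ≤-trans J≤1+πi (proj₁ after) , subst (value π x <_) occurrence-at-maximum (proj₂ after)
      where
      after : value π i < value π x × value π x < value π j
      after = occurrence-after π inj occ x (subst (_< toℕ x) (sym j≡J) J<x)

splitBlocks : ∀ J k → Blocks (suc (J + k))
splitBlocks J k = (interval 0 J , J) ∷ (interval (J + k) (suc (J + k)) , 1) ∷ (interval J (J + k) , k) ∷ []

lettersAt-splitBlocks-< : ∀ {J k p} → p < J → lettersAt (splitBlocks J k) p ≡ interval 0 J
lettersAt-splitBlocks-< {J} {k} p<J =
  lettersAt-∷-< ((interval (J + k) (suc (J + k)) , 1) ∷ (interval J (J + k) , k) ∷ []) p<J

lettersAt-splitBlocks-≡ : ∀ {J k} → lettersAt (splitBlocks J k) J ≡ interval (J + k) (suc (J + k))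
lettersAt-splitBlocks-≡ {J} {k} =
  trans (lettersAt-∷-≥ right (≤-refl {J})) (cong (lettersAt right) (n∸n≡0 J))
  where
  right : Blocks (suc (J + k))
  right = (interval (J + k) (suc (J + k)) , 1) ∷ (interval J (J + k) , k) ∷ []

lettersAt-splitBlocks-> : ∀ {J k p} → J < p → p < suc (J + k) → lettersAt (splitBlocks J k) p ≡ interval J (J + k)
lettersAt-splitBlocks-> {J} {k} {p} J<p p<n =
  trans (lettersAt-∷-≥ ((interval (J + k) (suc (J + k)) , 1) ∷ (interval J (J + k) , k) ∷ []) (<⇒≤ J<p))
        (trans (lettersAt-∷-≥ ((interval J (J + k) , k) ∷ []) (m<n⇒0<n∸m J<p)) (lettersAt-∷-< [] offset<k))
  where
  offset<k : p ∸ J ∸ 1 < k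
  offset<k = subst₂ _<_ (sym (trans (∸-+-assoc p J 1) (cong (p ∸_) (+-comm J 1)))) (m+n∸m≡n (suc J) k)
                        (∸-monoˡ-< p<n J<p)

T-splitBlocks : ∀ {J k p} (b : Fin (suc (J + k))) → p < suc (J + k) →
                T (lettersAt (splitBlocks J k) p b) ⇔ SplitLetter J k p (toℕ b)
T-splitBlocks {J} {k} {p} b p<n with <-cmp p J
... | tri< p<J _ _ = subst (λ S → T (S b) ⇔ SplitLetter J k p (toℕ b)) (sym (lettersAt-splitBlocks-< p<J)) (mk⇔
  (λ h → (λ _ → proj₂ (Equivalence.to (T-inRange {0} {J}) h)) , (λ p≡J → ⊥-elim (<-irrefl p≡J p<J)) , λ J<p → ⊥-elim (<-asym p<J J<p))
  (λ (before , _ , _) → Equivalence.from (T-inRange {0} {J}) (z≤n , before p<J)))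
... | tri≈ _ refl _ = subst (λ S → T (S b) ⇔ SplitLetter J k J (toℕ b)) (sym (lettersAt-splitBlocks-≡ {J} {k})) (mk⇔
  (λ h → (λ J<J → ⊥-elim (<-irrefl refl J<J)) , (λ _ → Equivalence.to T-inRange-suc h) , λ J<J → ⊥-elim (<-irrefl refl J<J))
  (λ (_ , at , _) → Equivalence.from T-inRange-suc (at refl)))
... | tri> _ _ J<p = subst (λ S → T (S b) ⇔ SplitLetter J k p (toℕ b)) (sym (lettersAt-splitBlocks-> J<p p<n)) (mk⇔
  (λ h → (λ p<J → ⊥-elim (<-asym p<J J<p)) , (λ p≡J → ⊥-elim (<-irrefl (sym p≡J) J<p)) , λ _ → Equivalence.to (T-inRange {J} {J + k}) h)
  (λ (_ , _ , after) → Equivalence.from (T-inRange {J} {J + k}) (after J<p)))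

disjoint-splitBlocks : ∀ J k → DisjointBlocks (splitBlocks J k)
disjoint-splitBlocks J k =
    (disjoint-intervals 0 J (J + k) (suc (J + k)) (m≤m+n J k) ∷ disjoint-intervals 0 J J (J + k) ≤-refl ∷ [])
  ∷ ((λ a a∈N a∈M → disjoint-intervals J (J + k) (J + k) (suc (J + k)) ≤-refl a a∈M a∈N) ∷ [])
  ∷ []
  ∷ []

blocksLength-splitBlocks : ∀ J k → blocksLength (splitBlocks J k) ≡ suc (J + k)
blocksLength-splitBlocks J k = trans (cong (λ m → J + suc m) (+-identityʳ k)) (+-suc J k)

blocksCount-splitBlocks : ∀ J k → blocksCount (splitBlocks J k) ≡ J ! * k !
blocksCount-splitBlocks J k = begin
  fallingFactorial (size L) J * (fallingFactorial (size N) 1 * (fallingFactorial (size M) k * 1))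
    ≡⟨ cong₂ (λ a b → fallingFactorial a J * (fallingFactorial b 1 * (fallingFactorial (size M) k * 1)))
             (size-interval {lo = 0} (≤-trans (m≤m+n J k) (n≤1+n _))) (trans (size-interval {lo = J + k} ≤-refl) (m+n∸n≡m 1 (J + k))) ⟩
  fallingFactorial J J * (1 * (fallingFactorial (size M) k * 1))
    ≡⟨ cong (λ a → fallingFactorial J J * (1 * (fallingFactorial a k * 1)))
            (trans (size-interval {lo = J} (n≤1+n _)) (m+n∸m≡n J k)) ⟩
  fallingFactorial J J * (1 * (fallingFactorial k k * 1))
    ≡⟨ cong₂ (λ a b → a * (1 * (b * 1))) (fallingFactorial-! J) (fallingFactorial-! k) ⟩
  J ! * (1 * (k ! * 1))
    ≡⟨ cong (J ! *_) (trans (*-identityˡ _) (*-identityʳ _)) ⟩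
  J ! * k ! ∎
  where
  open ≡-Reasoning
  L M N : Letters (suc (J + k))
  L = interval 0 J
  N = interval (J + k) (suc (J + k))
  M = interval J (J + k)

module _ {J k} (π : Vec (Fin (suc (J + k))) (suc (J + k))) (split : Split J k π) where

  private
    jJ : Fin (suc (J + k))
    jJ = fromℕ< (s≤s (m≤m+n J k))
    jJ≡J : toℕ jJ ≡ J
    jJ≡J = toℕ-fromℕ< (s≤s (m≤m+n J k))
    πjJ≡max : value π jJ ≡ J + k
    πjJ≡max = proj₁ (proj₂ (split jJ)) jJ≡J

  split⇒nHasRight : T (nHasRight k π)
  split⇒nHasRight = Equivalence.from (T-nHasRight k π) (jJ , trans (cong suc jJ≡J) (sym (m+n∸n≡m (suc J) k)) , cong suc πjJ≡max)

  split⇒occurrence : 0 < J → ∃₂ (Occurrence shadingP π)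
  split⇒occurrence 0<J = i , jJ , s<s (subst (toℕ i <_) (sym jJ≡J) i<J) , s<s πi<πjJ
                        , e01 ∷ e02 ∷ e11 ∷ e12 ∷ e20 ∷ e22 ∷ []
    where
    maxPrefix : ∃ λ a → toℕ a < J × (∀ x → toℕ x < J → value π x ≤ value π a)
    maxPrefix = argmax-below (value π) 0<J (m≤n⇒m≤1+n (m≤m+n J k))
    i : Fin (suc (J + k))
    i = proj₁ maxPrefix
    i<J : toℕ i < J
    i<J = proj₁ (proj₂ maxPrefix)
    i-maximal : ∀ x → toℕ x < J → value π x ≤ value π i
    i-maximal = proj₂ (proj₂ maxPrefix)
    πi<J : value π i < J
    πi<J = proj₁ (split i) i<J
    πi<πjJ : value π i < value π jJ
    πi<πjJ = subst (value π i <_) (sym πjJ≡max) (≤-trans πi<J (m≤m+n J k))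
    ¬above-max : ∀ x → ¬ (val π jJ < val π x)
    ¬above-max x jJ<x = <⇒≱ (subst (_< suc (value π x)) (cong suc πjJ≡max) jJ<x) (toℕ<n (lookup π x))
    ¬above-prefix : ∀ x → toℕ x < J → ¬ (val π i < val π x)
    ¬above-prefix x x<J πi<πx = <⇒≱ (s<s⁻¹ πi<πx) (i-maximal x x<J)
    e01 : ∀ x → ¬ InBox π i jJ (0 , 1) x
    e01 x ((_ , x<i) , (πi<πx , _)) = ¬above-prefix x (<-trans (s<s⁻¹ x<i) i<J) πi<πx
    e02 : ∀ x → ¬ InBox π i jJ (0 , 2) x
    e02 x (_ , (πjJ<πx , _)) = ¬above-max x πjJ<πx
    e11 : ∀ x → ¬ InBox π i jJ (1 , 1) x
    e11 x ((_ , x<jJ) , (πi<πx , _)) = ¬above-prefix x (subst (toℕ x <_) jJ≡J (s<s⁻¹ x<jJ)) πi<πx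
    e12 : ∀ x → ¬ InBox π i jJ (1 , 2) x
    e12 x (_ , (πjJ<πx , _)) = ¬above-max x πjJ<πx
    e20 : ∀ x → ¬ InBox π i jJ (2 , 0) x
    e20 x ((jJ<x , _) , (_ , πx<πi)) =
      <⇒≱ (<-≤-trans (s<s⁻¹ πx<πi) (<⇒≤ πi<J)) (proj₁ (proj₂ (proj₂ (split x)) (subst (_< toℕ x) jJ≡J (s<s⁻¹ jJ<x))))
    e22 : ∀ x → ¬ InBox π i jJ (2 , 2) x
    e22 x (_ , (πjJ<πx , _)) = ¬above-max x πjJ<πx

split⇔fitsInjectively : ∀ {J k} (π : Vec (Fin (suc (J + k))) (suc (J + k))) →
                        (Split J k π × Injective _≡_ _≡_ (lookup π)) ⇔ T (fitsInjectively (lettersAt (splitBlocks J k)) π)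
split⇔fitsInjectively π = ⇔-trans
  (mk⇔ (Product.map₁ (λ split x → Equivalence.from (T-splitBlocks (lookup π x) (toℕ<n x)) (split x)))
       (Product.map₁ (λ fits x → Equivalence.to (T-splitBlocks (lookup π x) (toℕ<n x)) (fits x))))
  (⇔-sym (T-fitsInjectively _ π))

T-containing : ∀ {n} k R (π : Vec (Fin n) n) → T (isPerm π ∧ (nHasRight k π ∧ contains12 R π)) ⇔
               (Injective _≡_ _≡_ (lookup π) × T (nHasRight k π) × ∃₂ (Occurrence R π))
T-containing k R π = mk⇔
  (Product.map (Equivalence.to (T-isPerm π)) (Product.map₂ (Equivalence.to (T-contains12 R π)) ∘ Equivalence.to T-∧)
   ∘ Equivalence.to T-∧)
  (Equivalence.from T-∧ ∘ Product.map (Equivalence.from (T-isPerm π))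
                                      (Equivalence.from T-∧ ∘ Product.map₂ (Equivalence.from (T-contains12 R π))))

containing-first-impossible : ∀ k (π : Vec (Fin (suc k)) (suc k)) →
                              ¬ T (isPerm π ∧ (nHasRight k π ∧ contains12 shadingP π))
containing-first-impossible k π = no-occurrence ∘ Equivalence.to (T-containing k shadingP π)
  where
  no-occurrence : ¬ (Injective _≡_ _≡_ (lookup π) × T (nHasRight k π) × ∃₂ (Occurrence shadingP π))
  no-occurrence (inj , nAt0 , i , j , occ) =
    n≮0 (subst (toℕ i <_) (occurrence-position {J = 0} π inj occ nAt0) (s<s⁻¹ (proj₁ occ)))


count-containing-first : ∀ k → countPerms (suc k) (λ π → nHasRight k π ∧ contains12 shadingP π) ≡ 0
count-containing-first k =
  trans (countPerms≡count (suc k) _) (count-none (containing-first-impossible k) (allWords (suc k) (suc k)))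

count-containing-at : ∀ J k → 0 < J → countPerms (suc (J + k)) (λ π → nHasRight k π ∧ contains12 shadingP π) ≡ J ! * k !
count-containing-at J k 0<J = begin
  countPerms n (λ π → nHasRight k π ∧ contains12 shadingP π)
    ≡⟨ countPerms≡count n _ ⟩
  count (λ π → isPerm π ∧ (nHasRight k π ∧ contains12 shadingP π)) (allWords n n)
    ≡⟨ count-cong (λ π → T-injective (⇔-trans (containing⇔split π) (split⇔fitsInjectively π))) (allWords n n) ⟩
  count (fitsInjectively (lettersAt (splitBlocks J k))) (allWords n n)
    ≡⟨ count-fitsInjectively n (splitBlocks J k) (blocksLength-splitBlocks J k) (disjoint-splitBlocks J k) ⟩
  blocksCount (splitBlocks J k)
    ≡⟨ blocksCount-splitBlocks J k ⟩
  J ! * k ! ∎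
  where
  open ≡-Reasoning
  n : ℕ
  n = suc (J + k)
  containing⇔split : ∀ π → T (isPerm π ∧ (nHasRight k π ∧ contains12 shadingP π)) ⇔ (Split J k π × Injective _≡_ _≡_ (lookup π))
  containing⇔split π = ⇔-trans (T-containing k shadingP π) (mk⇔
    (λ (inj , nAtJ , _ , _ , occ) → occurrence⇒split π inj occ nAtJ , inj)
    (λ (split , inj) → inj , split⇒nHasRight π split , split⇒occurrence π split 0<J))

count-containing : ∀ n → 2 ≤ n → ∀ i → i ≤ n ∸ 2 →
                   countPerms n (λ π → nHasRight i π ∧ contains12 shadingP π) ≡ i ! * (n ∸ 1 ∸ i) !
count-containing (suc (suc m)) _ i i≤m =
  trans (subst (λ l → countPerms (suc l) (λ π → nHasRight i π ∧ contains12 shadingP π) ≡ J ! * i !)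
               (m∸n+n≡m (m≤n⇒m≤1+n i≤m)) (count-containing-at J i (m<n⇒0<n∸m (s≤s i≤m))))
        (*-comm (J !) (i !))
  where
  J : ℕ
  J = suc m ∸ i
count-containing (suc zero) (s≤s ())

count-avoiding : ∀ n → 2 ≤ n → countPerms n (λ π → not (contains12 shadingP π))
                                   ≡ n ! ∸ sum (map (λ i → i ! * (n ∸ i ∸ 1) !) (upTo (n ∸ 1)))
count-avoiding n@(suc (suc m)) 2≤n = begin
  countPerms n (not ∘ contains12 shadingP)
    ≡⟨ m+n∸n≡m _ (sum (map containing (upTo n))) ⟨
  countPerms n (not ∘ contains12 shadingP) + sum (map containing (upTo n)) ∸ sum (map containing (upTo n))
    ≡⟨ cong (_∸ sum (map containing (upTo n))) (countPerms-not+sum≡! (suc m) (contains12 shadingP)) ⟩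
  n ! ∸ sum (map containing (upTo n))
    ≡⟨ cong (n ! ∸_) (sum-upTo-suc containing (suc m)) ⟩
  n ! ∸ (sum (map containing (upTo (suc m))) + containing (suc m))
    ≡⟨ cong₂ (λ s c → n ! ∸ (s + c)) (cong sum (map-cong-local (All.map containing≡ (all-upTo (suc m)))))
                                     (count-containing-first (suc m)) ⟩
  n ! ∸ (sum (map formula (upTo (suc m))) + 0)
    ≡⟨ cong (n ! ∸_) (+-identityʳ (sum (map formula (upTo (suc m))))) ⟩
  n ! ∸ sum (map formula (upTo (suc m))) ∎
  where
  open ≡-Reasoning
  containing formula : ℕ → ℕ
  containing i = countPerms n (λ π → nHasRight i π ∧ contains12 shadingP π)
  formula i = i ! * (n ∸ i ∸ 1) !
  containing≡ : ∀ {i} → i < suc m → containing i ≡ formula i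
  containing≡ {i} (s≤s i≤m) =
    trans (count-containing n 2≤n i i≤m) (cong (λ l → i ! * (l ∸ 1) !) (sym (+-∸-assoc 1 (m≤n⇒m≤1+n i≤m))))
count-avoiding (suc zero) (s≤s ())

proposition4p13 : (n : ℕ) → 2 ≤ n →
    ((i : ℕ) → i ≤ n ∸ 2 →
      countPerms n (λ π → nHasRight i π ∧ contains12 shadingP π) ≡ i ! * (n ∸ 1 ∸ i) !)
    × (countPerms n (λ π → not (contains12 shadingP π))
        ≡ n ! ∸ sum (map (λ i → i ! * (n ∸ i ∸ 1) !) (upTo (n ∸ 1))))
proposition4p13 n 2≤n = count-containing n 2≤n , count-avoiding n 2≤n
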